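{- Let $G=(V,c,M)$ be a marked symmetric graph with $|M|$ even. Let $z\notin V$, and let $C,D\subseteq V$ be marked cuts of $G$ such that $C\supseteq D$ or $C\cap D=\emptyset$. Define $C':=C(z/D)$ and $G'=(V',c',M'):=\mathrm{Collapse}(G,D,z)$. Then: 1. The value of $C$ in $G$ equals the value of $C'$ in $G'$. 2. If $C$ is a basic minimum odd marked cut of $G$ and $|D\cap M|$ is even, then $C'$ is a basic minimum odd marked cut of $G'$. Moreover, $|M'|$ is even and non-zero, and $M'\subsetneq M$.
   Context: A marked symmetric graph is $G=(V,c,M)$ with $V$ finite, $c:V\times V\to\mathbb{Q}_{\ge0}$ symmetric, and $M\subseteq V$ the marked vertices. A cut is a subset $C\subseteq V$, with $\bar C=V\setminus C$ and value $\sum_{u\in C,v\in\bar C}c(u,v)$. A marked cut is a cut $C$ such that both $C$ and $\bar C$ contain a marked vertex. An odd marked cut is a marked cut with $|C\cap M|$ odd. A minimum odd marked cut has minimum value among odd marked cuts. A basic minimum odd marked cut is a minimum odd marked cut with no proper subset that is also a minimum odd marked cut. Substitution. For $C,D\subseteq V$ with $C\supseteq D$ or $C\cap D=\emptyset$, and $z\notin V$, define $C(z/D)\subseteq (V\setminus D)\cup\{z\}$ by: - $C(z/D)=(C\setminus D)\cup\{z\}$ if $C\supseteq D$; - $C(z/D)=C$ if $C\cap D=\emptyset$. Collapse. $\mathrm{Collapse}(G,D,z)$ is the marked graph $(V',c',M')$ defined as follows: - $V'=(V\setminus D)\cup\{z\}$; - $c'(u,w)=c(u,w)$ for $u,w\in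 V\setminus D$; - $c'(u,z)=\sum_{x\in D}c(u,x)$ for $u\in V\setminus D$; - $c'(z,w)=\sum_{x\in D}c(x,w)$ for $w\in V\setminus D$; - $M'=M\setminus D$. -}

module Defs where

open import Data.Nat using (ℕ; zero; suc)
open import Data.Nat.Divisibility using (_∣_)
open import Data.Fin using (Fin; zero; suc; _≟_)
open import Data.Fin.Subset using (Subset; _∈_; _∉_; _⊆_; _⊂_; _∩_; _∪_; _─_; ⁅_⁆; ∣_∣; Nonempty; Empty)
open import Data.Vec using (lookup)
open import Data.Bool using (Bool; true; false; if_then_else_)
open import Data.Rational using (ℚ; 0ℚ; _+_; _≤_)
open import Data.Product using (_×_; Σ; _,_)
open import Data.Sum using (_⊎_; inj₁; inj₂)
open import Relation.Nullary using (¬_; does)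
open import Relation.Binary.PropositionalEquality using (_≡_)

-- Vertices are drawn from a finite "universe" Fin N; the vertex set V of a
-- graph is a subset of the universe.  This lets a fresh vertex z ∉ V be
-- added (for Collapse) without changing the ambient type.

Even Odd : ℕ → Set
Even n = 2 ∣ n
Odd n = ¬ (2 ∣ n)

sumFin : ∀ {n} → (Fin n → ℚ) → ℚ
sumFin {zero}  f = 0ℚ
sumFin {suc n} f = f zero + sumFin (λ i → f (suc i))

sumOver : ∀ {n} → Subset n → (Fin n → ℚ) → ℚ
sumOver S f = sumFin (λ i → if lookup S i then f i else 0ℚ)

record MarkedGraph (N : ℕ) : Set where
  field
    V : Subset N
    c : Fin N → Fin N → ℚ
    M : Subset N

open MarkedGraph public

IsMarkedSymGraph : ∀ {N} → MarkedGraph N → Set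
IsMarkedSymGraph G =
  (∀ u w → u ∈ V G → w ∈ V G → c G u w ≡ c G w u) ×
  (∀ u w → u ∈ V G → w ∈ V G → 0ℚ ≤ c G u w) ×
  (M G ⊆ V G)

cutValue : ∀ {N} → MarkedGraph N → Subset N → ℚ
cutValue G C = sumOver C (λ u → sumOver (V G ─ C) (λ v → c G u v))

IsCut : ∀ {N} → MarkedGraph N → Subset N → Set
IsCut G C = C ⊆ V G

IsMarkedCut : ∀ {N} → MarkedGraph N → Subset N → Set
IsMarkedCut G C = IsCut G C × Nonempty (C ∩ M G) × Nonempty ((V G ─ C) ∩ M G)

IsOddMarkedCut : ∀ {N} → MarkedGraph N → Subset N → Set
IsOddMarkedCut G C = IsMarkedCut G C × Odd ∣ C ∩ M G ∣

IsMinOddMarkedCut : ∀ {N} → MarkedGraph N → Subset N → Set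
IsMinOddMarkedCut G C =
  IsOddMarkedCut G C × (∀ D → IsOddMarkedCut G D → cutValue G C ≤ cutValue G D)

IsBasicMinOddMarkedCut : ∀ {N} → MarkedGraph N → Subset N → Set
IsBasicMinOddMarkedCut G C =
  IsMinOddMarkedCut G C × (∀ D → D ⊂ C → ¬ IsMinOddMarkedCut G D)

Nested : ∀ {N} → Subset N → Subset N → Set
Nested C D = D ⊆ C ⊎ Empty (C ∩ D)

substCut : ∀ {N} (C D : Subset N) (z : Fin N) → Nested C D → Subset N
substCut C D z (inj₁ _) = (C ─ D) ∪ ⁅ z ⁆
substCut C D z (inj₂ _) = C

-- Collapse(G, D, z); c'(z,z) (not specified in the paper, never used by
-- cuts) is set to 0.
collapse : ∀ {N} → MarkedGraph N → Subset N → Fin N → MarkedGraph N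
collapse G D z = record
  { V = (V G ─ D) ∪ ⁅ z ⁆
  ; c = c'
  ; M = M G ─ D
  }
  where
  c' : Fin _ → Fin _ → ℚ
  c' u w with does (u ≟ z) | does (w ≟ z)
  ... | true  | true  = 0ℚ
  ... | true  | false = sumOver D (λ x → c G x w)
  ... | false | true  = sumOver D (λ x → c G u x)
  ... | false | false = c G u w

-- Contracting D to z, C ↦ C(z/D), maps the cuts of G nested with D onto the cuts of
-- the collapsed graph G′.  It preserves values: the complement of C(z/D) in G′ is
-- (V ∖ C)(z/D), and on whichever side D lies, the edges into D are exactly what c′
-- sums onto z.  As z is unmarked and C contains either all marks of D or none,
-- |C(z/D) ∩ M′| has the parity of |C ∩ M| when |D ∩ M| is even; and when |M| is even
-- an odd cut automatically has marks on both sides.  So odd marked cuts of G′ are the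
-- contractions of odd marked cuts of G with the same values, and minimality carries
-- over; basicness does too, since contraction reflects strict inclusion (a vertex of
-- the nonempty D witnesses a missing z).

module Submission where

open import Defs
open import Algebra.Bundles using (CommutativeMonoid)
open import Data.Bool using (true; false; if_then_else_; _∧_; _∨_)
open import Data.Bool.Properties using (∨-identityʳ)
open import Data.Empty using (⊥-elim)
open import Data.Fin using (Fin; zero; suc; _≟_)
open import Data.Fin.Subset
  using (Subset; _∈_; _∉_; _⊆_; _⊂_; _∩_; _∪_; _─_; ⁅_⁆; ∣_∣; Nonempty; Empty; ⊥; inside; outside)
open import Data.Fin.Subset.Properties
  using ( _∈?_; nonempty?; ⊆-antisym; ∉⊥; x∈⁅x⁆; x∈⁅y⁆⇒x≡y; x∉⁅y⁆⇒x≢y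
        ; p⊆p∪q; q⊆p∪q; x∈p∪q⁺; x∈p∪q⁻; p∩q⊆p; p∩q⊆q; x∈p∩q⁺; x∈p∩q⁻; ∩-comm
        ; p─q⊆p; x∈p∧x∉q⇒x∈p─q; p─q─r≡p─q∪r; p─q─r≡p─r─q; p∩q≢∅⇒p─q⊂p
        ; drop-∷-Empty; Empty-unique; ∣⊥∣≡0; x∈p⇒∣p-x∣<∣p∣ )
open import Data.Nat using (ℕ; zero; suc; _<_)
  renaming (_+_ to _+ℕ_)
open import Data.Nat.Divisibility using (_∣0; ∣m∣n⇒∣m+n; ∣m+n∣m⇒∣n)
import Data.Nat.Properties as ℕ
open import Data.Product using (_×_; Σ-syntax; ∃-syntax; _,_; proj₁; proj₂)
open import Data.Rational using (ℚ; 0ℚ; _+_; _≤_)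
open import Data.Rational.Properties
  using (+-0-commutativeMonoid; +-identityˡ; +-identityʳ; module ≤-Reasoning)
open import Data.Sum using (inj₁; inj₂)
open import Data.Vec using ([]; _∷_; here; there)
open import Function using (_∘_; _⇔_; mk⇔; Equivalence)
open import Relation.Nullary using (¬_; Dec; yes; no)
open import Relation.Binary.PropositionalEquality
open import Algebra.Properties.CommutativeSemigroup
  (CommutativeMonoid.commutativeSemigroup +-0-commutativeMonoid) using (interchange)

private
  variable
    n : ℕ
    x : Fin n
    p q : Subset n
    f g : Fin n → ℚ

-- Set algebra

x∈p─q⇒x∉q : ∀ (p q : Subset n) → x ∈ p ─ q → x ∉ q
x∈p─q⇒x∉q (_ ∷ p) (inside ∷ q) () here
x∈p─q⇒x∉q (_ ∷ p) (outside ∷ q) here ()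
x∈p─q⇒x∉q (_ ∷ p) (_ ∷ q) (there x∈p─q) (there x∈q) = x∈p─q⇒x∉q p q x∈p─q x∈q

x∈p─q⁻ : ∀ (p q : Subset n) → x ∈ p ─ q → x ∈ p × x ∉ q
x∈p─q⁻ p q x∈p─q = p─q⊆p p q x∈p─q , x∈p─q⇒x∉q p q x∈p─q

p─q∪q≡p : q ⊆ p → (p ─ q) ∪ q ≡ p
p─q∪q≡p {q = q} {p = p} q⊆p = ⊆-antisym ⊆p ⊇p
  where
  ⊆p : (p ─ q) ∪ q ⊆ p
  ⊆p x∈ with x∈p∪q⁻ (p ─ q) q x∈
  ... | inj₁ x∈p─q = p─q⊆p p q x∈p─q
  ... | inj₂ x∈q   = q⊆p x∈q
  ⊇p : p ⊆ (p ─ q) ∪ q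
  ⊇p {x} x∈p with x ∈? q
  ... | yes x∈q = x∈p∪q⁺ (inj₂ x∈q)
  ... | no  x∉q = x∈p∪q⁺ (inj₁ (x∈p∧x∉q⇒x∈p─q x∈p x∉q))

p∩q≡∅⇒p─q≡p : Empty (p ∩ q) → p ─ q ≡ p
p∩q≡∅⇒p─q≡p {p = p} {q = q} p∩q≡∅ = ⊆-antisym (p─q⊆p p q)
  (λ x∈p → x∈p∧x∉q⇒x∈p─q x∈p (λ x∈q → p∩q≡∅ (_ , x∈p∩q⁺ (x∈p , x∈q))))

p∪q─q≡p─q : ∀ (p q : Subset n) → (p ∪ q) ─ q ≡ p ─ q
p∪q─q≡p─q []      []            = refl
p∪q─q≡p─q (_ ∷ p) (inside  ∷ q) = cong (outside ∷_) (p∪q─q≡p─q p q)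
p∪q─q≡p─q (s ∷ p) (outside ∷ q) = cong₂ _∷_ (∨-identityʳ s) (p∪q─q≡p─q p q)
  where open import Data.Bool.Properties using (∨-identityʳ)

p∪r─[q∪r]≡p─[q∪r] : ∀ (p q r : Subset n) → (p ∪ r) ─ (q ∪ r) ≡ p ─ (q ∪ r)
p∪r─[q∪r]≡p─[q∪r] []      []            []            = refl
p∪r─[q∪r]≡p─[q∪r] (_ ∷ p) (inside  ∷ q) (_       ∷ r) = cong (outside ∷_) (p∪r─[q∪r]≡p─[q∪r] p q r)
p∪r─[q∪r]≡p─[q∪r] (_ ∷ p) (outside ∷ q) (inside  ∷ r) = cong (outside ∷_) (p∪r─[q∪r]≡p─[q∪r] p q r)
p∪r─[q∪r]≡p─[q∪r] (s ∷ p) (outside ∷ q) (outside ∷ r) =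
  cong₂ _∷_ (∨-identityʳ s) (p∪r─[q∪r]≡p─[q∪r] p q r)

─-distribʳ-∪ : ∀ (p q r : Subset n) → (p ∪ q) ─ r ≡ (p ─ r) ∪ (q ─ r)
─-distribʳ-∪ []      []      []            = refl
─-distribʳ-∪ (_ ∷ p) (_ ∷ q) (inside  ∷ r) = cong (outside ∷_) (─-distribʳ-∪ p q r)
─-distribʳ-∪ (_ ∷ p) (_ ∷ q) (outside ∷ r) = cong (_ ∷_) (─-distribʳ-∪ p q r)

p─r─[q─r]≡p─q : ∀ {p q r : Subset n} → r ⊆ q → (p ─ r) ─ (q ─ r) ≡ p ─ q
p─r─[q─r]≡p─q {p = p} {q} {r} r⊆q = begin
  p ─ r ─ (q ─ r)     ≡⟨ p─q─r≡p─r─q p r (q ─ r) ⟩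
  p ─ (q ─ r) ─ r     ≡⟨ p─q─r≡p─q∪r p (q ─ r) r ⟩
  p ─ ((q ─ r) ∪ r)   ≡⟨ cong (p ─_) (p─q∪q≡p r⊆q) ⟩
  p ─ q               ∎
  where open ≡-Reasoning

y∉p⇒p-y≡p : ∀ {p : Subset n} {y} → y ∉ p → p ─ ⁅ y ⁆ ≡ p
y∉p⇒p-y≡p {p = p} {y} y∉p = p∩q≡∅⇒p─q≡p λ (_ , x∈) →
  let x∈p , x∈⁅y⁆ = x∈p∩q⁻ p ⁅ y ⁆ x∈ in y∉p (subst (_∈ p) (x∈⁅y⁆⇒x≡y y x∈⁅y⁆) x∈p)

y∉q⇒⁅y⁆─q≡⁅y⁆ : ∀ {q : Subset n} {y} → y ∉ q → ⁅ y ⁆ ─ q ≡ ⁅ y ⁆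
y∉q⇒⁅y⁆─q≡⁅y⁆ {q = q} {y} y∉q = p∩q≡∅⇒p─q≡p λ (_ , x∈) →
  let x∈⁅y⁆ , x∈q = x∈p∩q⁻ ⁅ y ⁆ q x∈ in y∉q (subst (_∈ q) (x∈⁅y⁆⇒x≡y y x∈⁅y⁆) x∈q)

[r─q]∩p≡p─q : ∀ {p q r : Subset n} → p ⊆ r → (r ─ q) ∩ p ≡ p ─ q
[r─q]∩p≡p─q {p = p} {q} {r} p⊆r = ⊆-antisym
  (λ x∈ → let x∈r─q , x∈p = x∈p∩q⁻ (r ─ q) p x∈
          in x∈p∧x∉q⇒x∈p─q x∈p (x∈p─q⇒x∉q r q x∈r─q))
  (λ x∈ → let x∈p , x∉q = x∈p─q⁻ p q x∈
          in x∈p∩q⁺ (x∈p∧x∉q⇒x∈p─q (p⊆r x∈p) x∉q , x∈p))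

-- Cardinality and parity

∣p∣≡∣p─q∣+∣p∩q∣ : ∀ (p q : Subset n) → ∣ p ∣ ≡ ∣ p ─ q ∣ +ℕ ∣ p ∩ q ∣
∣p∣≡∣p─q∣+∣p∩q∣ []            []            = refl
∣p∣≡∣p─q∣+∣p∩q∣ (inside  ∷ p) (inside  ∷ q) =
  trans (cong suc (∣p∣≡∣p─q∣+∣p∩q∣ p q)) (sym (ℕ.+-suc ∣ p ─ q ∣ ∣ p ∩ q ∣))
∣p∣≡∣p─q∣+∣p∩q∣ (inside  ∷ p) (outside ∷ q) = cong suc (∣p∣≡∣p─q∣+∣p∩q∣ p q)
∣p∣≡∣p─q∣+∣p∩q∣ (outside ∷ p) (inside  ∷ q) = ∣p∣≡∣p─q∣+∣p∩q∣ p q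
∣p∣≡∣p─q∣+∣p∩q∣ (outside ∷ p) (outside ∷ q) = ∣p∣≡∣p─q∣+∣p∩q∣ p q

odd⇒nonempty : ∀ {n} {p : Subset n} → Odd ∣ p ∣ → Nonempty p
odd⇒nonempty {n} {p} odd with nonempty? p
... | yes ne = ne
... | no  p≡∅ = ⊥-elim (odd (subst Even (sym ∣p∣≡0) (2 ∣0)))
  where
  ∣p∣≡0 : ∣ p ∣ ≡ 0
  ∣p∣≡0 = trans (cong ∣_∣ (Empty-unique p≡∅)) (∣⊥∣≡0 n)

nonempty⇒∣p∣≢0 : Nonempty p → ¬ ∣ p ∣ ≡ 0
nonempty⇒∣p∣≢0 {p = p} (x , x∈p) ∣p∣≡0 =
  ℕ.n≮0 (subst (∣ p ─ ⁅ x ⁆ ∣ <_) ∣p∣≡0 (x∈p⇒∣p-x∣<∣p∣ x∈p))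

odd⇔odd-─ : Even ∣ p ∩ q ∣ → Odd ∣ p ∣ ⇔ Odd ∣ p ─ q ∣
odd⇔odd-─ {p = p} {q = q} even∩ = mk⇔
  (λ odd even─ → odd (subst Even (sym split) (∣m∣n⇒∣m+n even─ even∩)))
  (λ odd─ even → odd─ (∣m+n∣m⇒∣n (subst Even split′ even) even∩))
  where
  split  = ∣p∣≡∣p─q∣+∣p∩q∣ p q
  split′ = trans split (ℕ.+-comm ∣ p ─ q ∣ ∣ p ∩ q ∣)

even∧odd∩⇒odd-─ : Even ∣ p ∣ → Odd ∣ p ∩ q ∣ → Odd ∣ p ─ q ∣
even∧odd∩⇒odd-─ {p = p} {q = q} even odd∩ even─ =
  odd∩ (∣m+n∣m⇒∣n (subst Even (∣p∣≡∣p─q∣+∣p∩q∣ p q) even) even─)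

even∧even∩⇒even-─ : Even ∣ p ∣ → Even ∣ p ∩ q ∣ → Even ∣ p ─ q ∣
even∧even∩⇒even-─ {p = p} {q = q} even even∩ =
  ∣m+n∣m⇒∣n (subst Even (trans (∣p∣≡∣p─q∣+∣p∩q∣ p q) (ℕ.+-comm ∣ p ─ q ∣ ∣ p ∩ q ∣)) even) even∩

-- Sums over subsets

sumOver-cong : (∀ {x} → x ∈ p → f x ≡ g x) → sumOver p f ≡ sumOver p g
sumOver-cong {p = []}          f≗g = refl
sumOver-cong {p = inside  ∷ p} f≗g = cong₂ _+_ (f≗g here) (sumOver-cong {p = p} (f≗g ∘ there))
sumOver-cong {p = outside ∷ p} f≗g = cong (0ℚ +_) (sumOver-cong {p = p} (f≗g ∘ there))

sumOver-0 : ∀ (p : Subset n) → sumOver p (λ _ → 0ℚ) ≡ 0ℚ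
sumOver-0 []      = refl
sumOver-0 (s ∷ p) = trans (cong₂ _+_ (if-0 s) (sumOver-0 p)) (+-identityˡ 0ℚ)
  where
  if-0 : ∀ b → (if b then 0ℚ else 0ℚ) ≡ 0ℚ
  if-0 true  = refl
  if-0 false = refl

sumOver-+ : ∀ (p : Subset n) f g → sumOver p (λ x → f x + g x) ≡ sumOver p f + sumOver p g
sumOver-+ []      f g = sym (+-identityˡ 0ℚ)
sumOver-+ (s ∷ p) f g = trans
  (cong₂ _+_ (if-+ s) (sumOver-+ p (f ∘ suc) (g ∘ suc)))
  (interchange (if s then f zero else 0ℚ) (if s then g zero else 0ℚ) _ _)
  where
  if-+ : ∀ b → (if b then f zero + g zero else 0ℚ)
             ≡ (if b then f zero else 0ℚ) + (if b then g zero else 0ℚ)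
  if-+ true  = refl
  if-+ false = sym (+-identityˡ 0ℚ)

sumOver-comm : ∀ {m} (p : Subset n) (q : Subset m) (h : Fin n → Fin m → ℚ) →
  sumOver p (λ x → sumOver q (h x)) ≡ sumOver q (λ y → sumOver p (λ x → h x y))
sumOver-comm []      q h = sym (sumOver-0 q)
sumOver-comm (s ∷ p) q h = begin
  (if s then sumOver q (h zero) else 0ℚ) + sumOver p (λ x → sumOver q (h (suc x)))
    ≡⟨ cong₂ _+_ (if-sumOver s) (sumOver-comm p q (h ∘ suc)) ⟩
  sumOver q (λ y → if s then h zero y else 0ℚ) + sumOver q (λ y → sumOver p (λ x → h (suc x) y))
    ≡⟨ sym (sumOver-+ q _ _) ⟩
  sumOver q (λ y → sumOver (s ∷ p) (λ x → h x y)) ∎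
  where
  open ≡-Reasoning
  if-sumOver : ∀ b → (if b then sumOver q (h zero) else 0ℚ)
                   ≡ sumOver q (λ y → if b then h zero y else 0ℚ)
  if-sumOver true  = refl
  if-sumOver false = sym (sumOver-0 q)

sumOver-∪ : ∀ (p q : Subset n) f → Empty (p ∩ q) → sumOver (p ∪ q) f ≡ sumOver p f + sumOver q f
sumOver-∪ []      []      f _      = sym (+-identityˡ 0ℚ)
sumOver-∪ (s ∷ p) (t ∷ q) f p∩q≡∅ = trans
  (cong₂ _+_ (if-∨ s t (λ s∧t → p∩q≡∅ (zero , subst (λ b → zero ∈ b ∷ p ∩ q) s∧t here)))
             (sumOver-∪ p q (f ∘ suc) (drop-∷-Empty p∩q≡∅)))
  (interchange (if s then f zero else 0ℚ) (if t then f zero else 0ℚ) _ _)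
  where
  if-∨ : ∀ b c → ¬ true ≡ b ∧ c → (if b ∨ c then f zero else 0ℚ)
                                 ≡ (if b then f zero else 0ℚ) + (if c then f zero else 0ℚ)
  if-∨ true  true  b∧c = ⊥-elim (b∧c refl)
  if-∨ true  false _   = sym (+-identityʳ (f zero))
  if-∨ false c     _   = sym (+-identityˡ _)

sumOver-⊥ : ∀ f → sumOver (⊥ {n}) f ≡ 0ℚ
sumOver-⊥ {n} f =
  trans (sumOver-cong {p = ⊥} {f = f} {g = λ _ → 0ℚ} (⊥-elim ∘ ∉⊥)) (sumOver-0 (⊥ {n}))

sumOver-⁅⁆ : ∀ {n} (y : Fin n) f → sumOver ⁅ y ⁆ f ≡ f y
sumOver-⁅⁆ {suc n} zero    f = trans (cong (f zero +_) (sumOver-⊥ (f ∘ suc))) (+-identityʳ (f zero))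
sumOver-⁅⁆ {suc n} (suc y) f = trans (+-identityˡ _) (sumOver-⁅⁆ y (f ∘ suc))

sumOver-split : ∀ {p q : Subset n} f → q ⊆ p → sumOver p f ≡ sumOver (p ─ q) f + sumOver q f
sumOver-split {p = p} {q} f q⊆p = trans
  (cong (λ r → sumOver r f) (sym (p─q∪q≡p q⊆p)))
  (sumOver-∪ (p ─ q) q f λ (_ , x∈) → let x∈p─q , x∈q = x∈p∩q⁻ (p ─ q) q x∈
                                       in x∈p─q⇒x∉q p q x∈p─q x∈q)

sumOver-collapse : ∀ {p q : Subset n} {y} f g → q ⊆ p → y ∉ p →
  (∀ {x} → x ∈ p ─ q → g x ≡ f x) → g y ≡ sumOver q f →
  sumOver ((p ─ q) ∪ ⁅ y ⁆) g ≡ sumOver p f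
sumOver-collapse {p = p} {q} {y} f g q⊆p y∉p g≗f gy = begin
  sumOver ((p ─ q) ∪ ⁅ y ⁆) g        ≡⟨ sumOver-∪ (p ─ q) ⁅ y ⁆ g y∉p─q ⟩
  sumOver (p ─ q) g + sumOver ⁅ y ⁆ g ≡⟨ cong₂ _+_ (sumOver-cong g≗f) (trans (sumOver-⁅⁆ y g) gy) ⟩
  sumOver (p ─ q) f + sumOver q f     ≡⟨ sym (sumOver-split f q⊆p) ⟩
  sumOver p f                         ∎
  where
  open ≡-Reasoning
  y∉p─q : Empty ((p ─ q) ∩ ⁅ y ⁆)
  y∉p─q (_ , x∈) with x∈p∩q⁻ (p ─ q) ⁅ y ⁆ x∈
  ... | x∈p─q , x∈⁅y⁆ rewrite x∈⁅y⁆⇒x≡y y x∈⁅y⁆ = y∉p (p─q⊆p p q x∈p─q)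

-- Odd marked cuts

oddMarkedCut⇒∣M∣≢0 : ∀ {N} {G : MarkedGraph N} {F} → IsOddMarkedCut G F → ¬ ∣ M G ∣ ≡ 0
oddMarkedCut⇒∣M∣≢0 {G = G} {F} ((_ , (x , x∈) , _) , _) = nonempty⇒∣p∣≢0 (x , p∩q⊆q F (M G) x∈)

module _ {N} (G : MarkedGraph N) (M⊆V : M G ⊆ V G) (even-M : Even ∣ M G ∣) {F : Subset N} where

  odd-complement : Odd ∣ F ∩ M G ∣ → Odd ∣ (V G ─ F) ∩ M G ∣
  odd-complement odd = subst (Odd ∘ ∣_∣) (sym ([r─q]∩p≡p─q M⊆V))
    (even∧odd∩⇒odd-─ {p = M G} {q = F} even-M (subst (Odd ∘ ∣_∣) (∩-comm F (M G)) odd))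

  mkOddMarkedCut : F ⊆ V G → Odd ∣ F ∩ M G ∣ → IsOddMarkedCut G F
  mkOddMarkedCut F⊆V odd = (F⊆V , odd⇒nonempty odd , odd⇒nonempty (odd-complement odd)) , odd

-- Collapsing a vertex set D into a fresh vertex z

module Collapse {N} (G : MarkedGraph N) (D : Subset N) (z : Fin N) where

  G' : MarkedGraph N
  G' = collapse G D z

  collapse-c : ∀ {u w} → u ≢ z → w ≢ z → c G' u w ≡ c G u w
  collapse-c {u} {w} u≢z w≢z with u ≟ z | w ≟ z
  ... | yes u≡z | _       = ⊥-elim (u≢z u≡z)
  ... | no _    | yes w≡z = ⊥-elim (w≢z w≡z)
  ... | no _    | no _    = refl

  collapse-c-zˡ : ∀ {w} → w ≢ z → c G' z w ≡ sumOver D (λ x → c G x w)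
  collapse-c-zˡ {w} w≢z with z ≟ z | w ≟ z
  ... | no z≢z | _       = ⊥-elim (z≢z refl)
  ... | yes _  | yes w≡z = ⊥-elim (w≢z w≡z)
  ... | yes _  | no _    = refl

  collapse-c-zʳ : ∀ {u} → u ≢ z → c G' u z ≡ sumOver D (c G u)
  collapse-c-zʳ {u} u≢z with u ≟ z | z ≟ z
  ... | yes u≡z | _      = ⊥-elim (u≢z u≡z)
  ... | no _    | no z≢z = ⊥-elim (z≢z refl)
  ... | no _    | yes _  = refl

  substCut-⁺ : ∀ {F x} (nest : Nested F D) → x ∈ F ─ D → x ∈ substCut F D z nest
  substCut-⁺ (inj₁ _) = p⊆p∪q ⁅ z ⁆
  substCut-⁺ {F} (inj₂ _) = p─q⊆p F D

  substCut-⁻ : ∀ {F x} (nest : Nested F D) → x ∈ substCut F D z nest → x ≢ z → x ∈ F ─ D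
  substCut-⁻ {F} {x} (inj₁ _) x∈ x≢z with x∈p∪q⁻ (F ─ D) ⁅ z ⁆ x∈
  ... | inj₁ x∈F─D = x∈F─D
  ... | inj₂ x∈⁅z⁆ = ⊥-elim (x≢z (x∈⁅y⁆⇒x≡y z x∈⁅z⁆))
  substCut-⁻ (inj₂ F∩D≡∅) x∈F _ = x∈p∧x∉q⇒x∈p─q x∈F (λ x∈D → F∩D≡∅ (_ , x∈p∩q⁺ (x∈F , x∈D)))

  z∈substCut⇒D⊆F : ∀ {F} → z ∉ F → (nest : Nested F D) → z ∈ substCut F D z nest → D ⊆ F
  z∈substCut⇒D⊆F z∉F (inj₁ D⊆F) _   = D⊆F
  z∈substCut⇒D⊆F z∉F (inj₂ _)   z∈F = ⊥-elim (z∉F z∈F)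

  z∉substCut⇒F∩D≡∅ : ∀ {F} (nest : Nested F D) → z ∉ substCut F D z nest → Empty (F ∩ D)
  z∉substCut⇒F∩D≡∅ (inj₁ _)     z∉ = ⊥-elim (z∉ (q⊆p∪q _ ⁅ z ⁆ (x∈⁅x⁆ z)))
  z∉substCut⇒F∩D≡∅ (inj₂ F∩D≡∅) _  = F∩D≡∅

  module _ (D⊆V : D ⊆ V G) (z∉V : z ∉ V G) where

    ∈V⇒≢z : ∀ {x} → x ∈ V G → x ≢ z
    ∈V⇒≢z x∈V refl = z∉V x∈V

    D⊆V─F : ∀ {F} → Empty (F ∩ D) → D ⊆ V G ─ F
    D⊆V─F F∩D≡∅ x∈D = x∈p∧x∉q⇒x∈p─q (D⊆V x∈D) (λ x∈F → F∩D≡∅ (_ , x∈p∩q⁺ (x∈F , x∈D)))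

    V─F∩D≡∅ : ∀ {F} → D ⊆ F → Empty ((V G ─ F) ∩ D)
    V─F∩D≡∅ {F} D⊆F (_ , x∈) =
      let x∈V─F , x∈D = x∈p∩q⁻ (V G ─ F) D x∈ in x∈p─q⇒x∉q (V G) F x∈V─F (D⊆F x∈D)

    complement-nested : ∀ {F} → Nested F D → Nested (V G ─ F) D
    complement-nested (inj₁ D⊆F)   = inj₂ (V─F∩D≡∅ D⊆F)
    complement-nested (inj₂ F∩D≡∅) = inj₁ (D⊆V─F F∩D≡∅)

    V'─substCut : ∀ {F} → z ∉ F → (nest : Nested F D) →
      V G' ─ substCut F D z nest ≡ substCut (V G ─ F) D z (complement-nested nest)
    V'─substCut {F} z∉F (inj₁ D⊆F) = begin
      ((V G ─ D) ∪ ⁅ z ⁆) ─ ((F ─ D) ∪ ⁅ z ⁆) ≡⟨ p∪r─[q∪r]≡p─[q∪r] (V G ─ D) (F ─ D) ⁅ z ⁆ ⟩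
      (V G ─ D) ─ ((F ─ D) ∪ ⁅ z ⁆)          ≡⟨ sym (p─q─r≡p─q∪r (V G ─ D) (F ─ D) ⁅ z ⁆) ⟩
      (V G ─ D) ─ (F ─ D) ─ ⁅ z ⁆             ≡⟨ cong (_─ ⁅ z ⁆) (p─r─[q─r]≡p─q D⊆F) ⟩
      V G ─ F ─ ⁅ z ⁆                         ≡⟨ y∉p⇒p-y≡p (z∉V ∘ p─q⊆p (V G) F) ⟩
      V G ─ F                                 ∎
      where open ≡-Reasoning
    V'─substCut {F} z∉F (inj₂ _) = begin
      ((V G ─ D) ∪ ⁅ z ⁆) ─ F          ≡⟨ ─-distribʳ-∪ (V G ─ D) ⁅ z ⁆ F ⟩
      (V G ─ D ─ F) ∪ (⁅ z ⁆ ─ F)     ≡⟨ cong₂ _∪_ (p─q─r≡p─r─q (V G) D F) (y∉q⇒⁅y⁆─q≡⁅y⁆ z∉F) ⟩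
      (V G ─ F ─ D) ∪ ⁅ z ⁆           ∎
      where open ≡-Reasoning

    cutValue-substCut : ∀ {C} → C ⊆ V G → (nest : Nested C D) →
      cutValue G C ≡ cutValue G' (substCut C D z nest)
    cutValue-substCut {C} C⊆V nest = begin
      cutValue G C
        ≡⟨ sym (double-sum nest) ⟩
      sumOver C' (λ u → sumOver (substCut (V G ─ C) D z (complement-nested nest)) (c G' u))
        ≡⟨ cong (λ S → sumOver C' (λ u → sumOver S (c G' u))) (sym (V'─substCut (z∉V ∘ C⊆V) nest)) ⟩
      cutValue G' C' ∎
      where
      open ≡-Reasoning
      C' = substCut C D z nest

      ∈V─C⇒≢z : ∀ {x} → x ∈ V G ─ C → x ≢ z
      ∈V─C⇒≢z = ∈V⇒≢z ∘ p─q⊆p (V G) C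

      double-sum : (nest : Nested C D) →
        sumOver (substCut C D z nest)
          (λ u → sumOver (substCut (V G ─ C) D z (complement-nested nest)) (c G' u))
        ≡ cutValue G C
      double-sum (inj₁ D⊆C) = sumOver-collapse _ _ D⊆C (z∉V ∘ C⊆V)
        (λ u∈C─D → sumOver-cong (collapse-c (∈V⇒≢z (C⊆V (p─q⊆p C D u∈C─D))) ∘ ∈V─C⇒≢z))
        (trans (sumOver-cong (collapse-c-zˡ ∘ ∈V─C⇒≢z))
               (sumOver-comm (V G ─ C) D (λ v x → c G x v)))
      double-sum (inj₂ C∩D≡∅) = sumOver-cong λ u∈C → let u≢z = ∈V⇒≢z (C⊆V u∈C) in
        sumOver-collapse _ _ (D⊆V─F C∩D≡∅) (z∉V ∘ p─q⊆p (V G) C)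
          (λ v∈ → collapse-c u≢z (∈V─C⇒≢z (p─q⊆p (V G ─ C) D v∈)))
          (collapse-c-zʳ u≢z)

    ∈V'⇒∈V─D : ∀ {x} → x ∈ V G' → x ≢ z → x ∈ V G ─ D
    ∈V'⇒∈V─D {x} x∈V' x≢z with x∈p∪q⁻ (V G ─ D) ⁅ z ⁆ x∈V'
    ... | inj₁ x∈V─D = x∈V─D
    ... | inj₂ x∈⁅z⁆ = ⊥-elim (x≢z (x∈⁅y⁆⇒x≡y z x∈⁅z⁆))

    substCut⊆V' : ∀ {F} → F ⊆ V G → (nest : Nested F D) → substCut F D z nest ⊆ V G'
    substCut⊆V' F⊆V nest {x} x∈ with x ≟ z
    ... | yes refl = q⊆p∪q (V G ─ D) ⁅ z ⁆ (x∈⁅x⁆ z)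
    ... | no  x≢z  = let x∈F , x∉D = x∈p─q⁻ _ D (substCut-⁻ nest x∈ x≢z)
                     in p⊆p∪q ⁅ z ⁆ (x∈p∧x∉q⇒x∈p─q (F⊆V x∈F) x∉D)

    substCut-surjective : ∀ {E} → E ⊆ V G' →
      Σ[ F ∈ Subset N ] F ⊆ V G × Σ[ nest ∈ Nested F D ] substCut F D z nest ≡ E
    substCut-surjective {E} E⊆V' with z ∈? E
    ... | yes z∈E = (E ─ ⁅ z ⁆) ∪ D , F⊆V , inj₁ (q⊆p∪q (E ─ ⁅ z ⁆) D) , contract
      where
      E-z⊆V─D : E ─ ⁅ z ⁆ ⊆ V G ─ D
      E-z⊆V─D x∈ = let x∈E , x∉⁅z⁆ = x∈p─q⁻ E ⁅ z ⁆ x∈ in ∈V'⇒∈V─D (E⊆V' x∈E) (x∉⁅y⁆⇒x≢y x∉⁅z⁆)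

      F⊆V : (E ─ ⁅ z ⁆) ∪ D ⊆ V G
      F⊆V x∈ with x∈p∪q⁻ (E ─ ⁅ z ⁆) D x∈
      ... | inj₁ x∈E-z = p─q⊆p (V G) D (E-z⊆V─D x∈E-z)
      ... | inj₂ x∈D   = D⊆V x∈D

      E-z∩D≡∅ : Empty ((E ─ ⁅ z ⁆) ∩ D)
      E-z∩D≡∅ (_ , x∈) = let x∈E-z , x∈D = x∈p∩q⁻ (E ─ ⁅ z ⁆) D x∈
                         in x∈p─q⇒x∉q (V G) D (E-z⊆V─D x∈E-z) x∈D

      ⁅z⁆⊆E : ⁅ z ⁆ ⊆ E
      ⁅z⁆⊆E x∈⁅z⁆ = subst (_∈ E) (sym (x∈⁅y⁆⇒x≡y z x∈⁅z⁆)) z∈E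

      contract : (((E ─ ⁅ z ⁆) ∪ D) ─ D) ∪ ⁅ z ⁆ ≡ E
      contract = begin
        (((E ─ ⁅ z ⁆) ∪ D) ─ D) ∪ ⁅ z ⁆ ≡⟨ cong (_∪ ⁅ z ⁆) (p∪q─q≡p─q (E ─ ⁅ z ⁆) D) ⟩
        (E ─ ⁅ z ⁆ ─ D) ∪ ⁅ z ⁆         ≡⟨ cong (_∪ ⁅ z ⁆) (p∩q≡∅⇒p─q≡p E-z∩D≡∅) ⟩
        (E ─ ⁅ z ⁆) ∪ ⁅ z ⁆             ≡⟨ p─q∪q≡p ⁅z⁆⊆E ⟩
        E                               ∎
        where open ≡-Reasoning
    ... | no z∉E = E , F⊆V , inj₂ E∩D≡∅ , refl
      where
      ∈E⇒∈V─D : ∀ {x} → x ∈ E → x ∈ V G ─ D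
      ∈E⇒∈V─D x∈E = ∈V'⇒∈V─D (E⊆V' x∈E) (λ { refl → z∉E x∈E })

      F⊆V : E ⊆ V G
      F⊆V = p─q⊆p (V G) D ∘ ∈E⇒∈V─D

      E∩D≡∅ : Empty (E ∩ D)
      E∩D≡∅ (_ , x∈) = let x∈E , x∈D = x∈p∩q⁻ E D x∈ in x∈p─q⇒x∉q (V G) D (∈E⇒∈V─D x∈E) x∈D

    substCut-reflects-⊂ : ∀ {F₁ F₂} → Nonempty D → F₁ ⊆ V G → F₂ ⊆ V G →
      (nest₁ : Nested F₁ D) (nest₂ : Nested F₂ D) →
      substCut F₁ D z nest₁ ⊂ substCut F₂ D z nest₂ → F₁ ⊂ F₂
    substCut-reflects-⊂ {F₁} {F₂} (d , d∈D) F₁⊆V F₂⊆V nest₁ nest₂ (⊆κ₂ , y , y∈κ₂ , y∉κ₁) =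
      F₁⊆F₂ , witness (y ≟ z)
      where
      D⊆F₂ : z ∈ substCut F₂ D z nest₂ → D ⊆ F₂
      D⊆F₂ = z∈substCut⇒D⊆F (z∉V ∘ F₂⊆V) nest₂

      F₁⊆F₂ : F₁ ⊆ F₂
      F₁⊆F₂ {x} x∈F₁ with x ∈? D | z ∈? substCut F₁ D z nest₁
      ... | yes x∈D | yes z∈κ₁ = D⊆F₂ (⊆κ₂ z∈κ₁) x∈D
      ... | yes x∈D | no  z∉κ₁ = ⊥-elim (z∉substCut⇒F∩D≡∅ nest₁ z∉κ₁ (x , x∈p∩q⁺ (x∈F₁ , x∈D)))
      ... | no  x∉D | _        = p─q⊆p F₂ D
        (substCut-⁻ nest₂ (⊆κ₂ (substCut-⁺ nest₁ (x∈p∧x∉q⇒x∈p─q x∈F₁ x∉D))) (∈V⇒≢z (F₁⊆V x∈F₁)))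

      witness : Dec (y ≡ z) → ∃[ x ] x ∈ F₂ × x ∉ F₁
      witness (yes refl) = d , D⊆F₂ y∈κ₂ d∈D
                         , λ d∈F₁ → z∉substCut⇒F∩D≡∅ nest₁ y∉κ₁ (d , x∈p∩q⁺ (d∈F₁ , d∈D))
      witness (no y≢z)   = let y∈F₂ , y∉D = x∈p─q⁻ F₂ D (substCut-⁻ nest₂ y∈κ₂ y≢z)
                           in y , y∈F₂ , λ y∈F₁ → y∉κ₁ (substCut-⁺ nest₁ (x∈p∧x∉q⇒x∈p─q y∈F₁ y∉D))

    module _ (M⊆V : M G ⊆ V G) (even-M : Even ∣ M G ∣) (even-D∩M : Even ∣ D ∩ M G ∣) where

      substCut∩M' : ∀ {F} (nest : Nested F D) → substCut F D z nest ∩ M G' ≡ (F ∩ M G) ─ D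
      substCut∩M' {F} nest = ⊆-antisym
        (λ x∈ → let x∈κ , x∈M─D = x∈p∩q⁻ _ (M G ─ D) x∈
                    x∈M , x∉D   = x∈p─q⁻ (M G) D x∈M─D
                    x∈F , _     = x∈p─q⁻ F D (substCut-⁻ nest x∈κ (∈V⇒≢z (M⊆V x∈M)))
                in x∈p∧x∉q⇒x∈p─q (x∈p∩q⁺ (x∈F , x∈M)) x∉D)
        (λ x∈ → let x∈F∩M , x∉D = x∈p─q⁻ (F ∩ M G) D x∈
                    x∈F , x∈M   = x∈p∩q⁻ F (M G) x∈F∩M
                in x∈p∩q⁺ (substCut-⁺ nest (x∈p∧x∉q⇒x∈p─q x∈F x∉D) , x∈p∧x∉q⇒x∈p─q x∈M x∉D))

      even-F∩M∩D : ∀ {F} → Nested F D → Even ∣ (F ∩ M G) ∩ D ∣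
      even-F∩M∩D {F} (inj₁ D⊆F) = subst (Even ∘ ∣_∣) D∩M≡F∩M∩D even-D∩M
        where
        D∩M≡F∩M∩D : D ∩ M G ≡ (F ∩ M G) ∩ D
        D∩M≡F∩M∩D = ⊆-antisym
          (λ x∈ → let x∈D , x∈M = x∈p∩q⁻ D (M G) x∈ in x∈p∩q⁺ (x∈p∩q⁺ (D⊆F x∈D , x∈M) , x∈D))
          (λ x∈ → let x∈F∩M , x∈D = x∈p∩q⁻ (F ∩ M G) D x∈
                  in x∈p∩q⁺ (x∈D , proj₂ (x∈p∩q⁻ F (M G) x∈F∩M)))
      even-F∩M∩D {F} (inj₂ F∩D≡∅) = subst Even (sym ∣F∩M∩D∣≡0) (2 ∣0)
        where
        ∣F∩M∩D∣≡0 : ∣ (F ∩ M G) ∩ D ∣ ≡ 0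
        ∣F∩M∩D∣≡0 = trans (cong ∣_∣ (Empty-unique λ (x , x∈) →
            let x∈F∩M , x∈D = x∈p∩q⁻ (F ∩ M G) D x∈
            in F∩D≡∅ (x , x∈p∩q⁺ (proj₁ (x∈p∩q⁻ F (M G) x∈F∩M) , x∈D))))
          (∣⊥∣≡0 N)

      odd⇔odd-substCut : ∀ {F} (nest : Nested F D) →
        Odd ∣ F ∩ M G ∣ ⇔ Odd ∣ substCut F D z nest ∩ M G' ∣
      odd⇔odd-substCut {F} nest =
        subst (λ S → Odd ∣ F ∩ M G ∣ ⇔ Odd ∣ S ∣) (sym (substCut∩M' nest))
          (odd⇔odd-─ {p = F ∩ M G} {q = D} (even-F∩M∩D nest))

      M'⊆V' : M G' ⊆ V G'
      M'⊆V' x∈ = let x∈M , x∉D = x∈p─q⁻ (M G) D x∈ in p⊆p∪q ⁅ z ⁆ (x∈p∧x∉q⇒x∈p─q (M⊆V x∈M) x∉D)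

      even-M' : Even ∣ M G' ∣
      even-M' = even∧even∩⇒even-─ {p = M G} even-M (subst (Even ∘ ∣_∣) (∩-comm D (M G)) even-D∩M)

      substCut-oddMarkedCut : ∀ {F} (nest : Nested F D) →
        IsOddMarkedCut G F → IsOddMarkedCut G' (substCut F D z nest)
      substCut-oddMarkedCut nest ((F⊆V , _) , odd) =
        mkOddMarkedCut G' M'⊆V' even-M' (substCut⊆V' F⊆V nest)
          (Equivalence.to (odd⇔odd-substCut nest) odd)

      substCut-oddMarkedCut⁻ : ∀ {F} → F ⊆ V G → (nest : Nested F D) →
        IsOddMarkedCut G' (substCut F D z nest) → IsOddMarkedCut G F
      substCut-oddMarkedCut⁻ F⊆V nest (_ , odd) =
        mkOddMarkedCut G M⊆V even-M F⊆V (Equivalence.from (odd⇔odd-substCut nest) odd)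

      substCut-basicMinOddMarkedCut : ∀ {C} → Nonempty D → (nest : Nested C D) →
        IsBasicMinOddMarkedCut G C → IsBasicMinOddMarkedCut G' (substCut C D z nest)
      substCut-basicMinOddMarkedCut {C} D≢∅ nest ((oddC , minC) , basicC) =
        (oddC' , minC') , basicC'
        where
        C⊆V = proj₁ (proj₁ oddC)
        C'  = substCut C D z nest
        oddC' = substCut-oddMarkedCut nest oddC

        minC' : ∀ E → IsOddMarkedCut G' E → cutValue G' C' ≤ cutValue G' E
        minC' E oddE with substCut-surjective (proj₁ (proj₁ oddE))
        ... | F , F⊆V , nestF , refl = begin
          cutValue G' C'                   ≡⟨ sym (cutValue-substCut C⊆V nest) ⟩
          cutValue G C                     ≤⟨ minC F (substCut-oddMarkedCut⁻ F⊆V nestF oddE) ⟩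
          cutValue G F                     ≡⟨ cutValue-substCut F⊆V nestF ⟩
          cutValue G' (substCut F D z nestF) ∎
          where open ≤-Reasoning

        basicC' : ∀ E → E ⊂ C' → ¬ IsMinOddMarkedCut G' E
        basicC' E E⊂C' (oddE , minE) with substCut-surjective (proj₁ (proj₁ oddE))
        ... | F , F⊆V , nestF , refl =
          basicC F (substCut-reflects-⊂ D≢∅ F⊆V C⊆V nestF nest E⊂C')
                   (substCut-oddMarkedCut⁻ F⊆V nestF oddE , minF)
          where
          minF : ∀ H → IsOddMarkedCut G H → cutValue G F ≤ cutValue G H
          minF H oddH = begin
            cutValue G F                       ≡⟨ cutValue-substCut F⊆V nestF ⟩
            cutValue G' (substCut F D z nestF) ≤⟨ minE C' oddC' ⟩
            cutValue G' C'                     ≡⟨ sym (cutValue-substCut C⊆V nest) ⟩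
            cutValue G C                       ≤⟨ minC H oddH ⟩
            cutValue G H                       ∎
            where open ≤-Reasoning

mainTheorem8 : ∀ {N : ℕ} (G : MarkedGraph N) → IsMarkedSymGraph G → Even ∣ M G ∣ →
    (z : Fin N) → z ∉ V G → (C D : Subset N) → IsMarkedCut G C → IsMarkedCut G D →
    (nest : Nested C D) →
    (cutValue G C ≡ cutValue (collapse G D z) (substCut C D z nest)) ×
    (IsBasicMinOddMarkedCut G C → Even ∣ D ∩ M G ∣ →
      IsBasicMinOddMarkedCut (collapse G D z) (substCut C D z nest) ×
      Even ∣ M (collapse G D z) ∣ × ¬ (∣ M (collapse G D z) ∣ ≡ 0) × M (collapse G D z) ⊂ M G)
mainTheorem8 G (_ , _ , M⊆V) even-M z z∉V C D (C⊆V , _) (D⊆V , (d , d∈D∩M) , _) nest =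
  cutValue-substCut D⊆V z∉V C⊆V nest , λ basicC even-D∩M →
    let basicC' = substCut-basicMinOddMarkedCut D⊆V z∉V M⊆V even-M even-D∩M D≢∅ nest basicC
    in basicC'
     , even-M' D⊆V z∉V M⊆V even-M even-D∩M
     , oddMarkedCut⇒∣M∣≢0 {G = G'} (proj₁ (proj₁ basicC'))
     , p∩q≢∅⇒p─q⊂p (M G) D (d , subst (d ∈_) (∩-comm D (M G)) d∈D∩M)
  where
  open Collapse G D z
  D≢∅ : Nonempty D
  D≢∅ = d , p∩q⊆p D (M G) d∈D∩M
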